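{- Let $\varphi_1,\varphi_2$ be fPIL formulas over $P$ and a De Morgan algebra $K$. Then $\varphi_1\sqcap\varphi_2\equiv\varphi_1\otimes\varphi_2$ (as fPCL formulas).
   Context: A De Morgan algebra $(K,\vee,\wedge,0,1,\overline{\cdot})$ is a bounded distributive lattice with bottom $0$, top $1$ and a map $k\mapsto\overline k$ with $\overline{\overline k}=k$ and the De Morgan laws. $P$ is a set of ports; a $K$-fuzzy interaction is $\alpha:P\to K$ with $\alpha(p)\ne0$ for some $p$; $fC(P,K)$ is the set of nonempty (finite) sets of $K$-fuzzy interactions. fPIL formulas: $\varphi::=true\mid p\mid\,!\varphi\mid\varphi\sqcup\varphi$, $\varphi_1\sqcap\varphi_2:=\,!(!\varphi_1\sqcup!\varphi_2)$, with $\|true\|(\alpha)=1$, $\|p\|(\alpha)=\alpha(p)$, $\|!\varphi\|(\alpha)=\overline{\|\varphi\|(\alpha)}$, $\|\varphi_1\sqcup\varphi_2\|(\alpha)=\|\varphi_1\|(\alpha)\vee\|\varphi_2\|(\alpha)$. fPCL formulas: $\zeta::=\varphi\mid\neg\zeta\mid\zeta\oplus\zeta\mid\zeta\uplus\zeta$, $\zeta\otimes\zeta':=\neg(\neg\zeta\oplus\neg\zeta')$; for $\gamma\in fC(P,K)$: $\|\varphi\|(\gamma)=\bigwedge_{\alpha\in\gamma}\|\varphi\|(\alpha)$, $\|\neg\zeta\|(\gamma)=\overline{\|\zeta\|(\gamma)}$, $\|\zeta_1\oplus\zeta_2\|(\gamma)=\|\zeta_1\|(\gamma)\vee\|\zeta_2\|(\gamma)$,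 $\|\zeta_1\uplus\zeta_2\|(\gamma)=\bigvee_{\gamma_1,\gamma_2\in fC(P,K),\,\gamma_1\cup\gamma_2=\gamma}(\|\zeta_1\|(\gamma_1)\wedge\|\zeta_2\|(\gamma_2))$. $\zeta_1\equiv\zeta_2$ means $\|\zeta_1\|(\gamma)=\|\zeta_2\|(\gamma)$ for all $\gamma\in fC(P,K)$, for an arbitrary De Morgan algebra $K$. -}

module Defs where

open import Level using (Level; _⊔_; suc)
open import Data.Product using (Σ; ∃; _×_; _,_)
open import Data.List using (List; []; _∷_; map; foldr; concatMap)
open import Data.List.NonEmpty using (List⁺; toList; fromList)
open import Data.Maybe using (Maybe; just; nothing)
open import Relation.Nullary using (¬_)
open import Relation.Binary using (Rel)
open import Algebra.Core using (Op₁; Op₂)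
open import Algebra.Definitions using (Identity; Involutive; Congruent₁)
open import Algebra.Lattice.Structures using (IsDistributiveLattice)

record DeMorganAlgebra (c ℓ : Level) : Set (suc (c ⊔ ℓ)) where
  infix  4 _≈_
  infixr 6 _∨_
  infixr 7 _∧_
  field
    Carrier : Set c
    _≈_     : Rel Carrier ℓ
    _∨_     : Op₂ Carrier
    _∧_     : Op₂ Carrier
    0#      : Carrier
    1#      : Carrier
    ‾_      : Op₁ Carrier
    isDistributiveLattice : IsDistributiveLattice _≈_ _∨_ _∧_
    ∨-identity : Identity _≈_ 0# _∨_
    ∧-identity : Identity _≈_ 1# _∧_
    ‾-cong     : Congruent₁ _≈_ ‾_
    ‾-involutive : Involutive _≈_ ‾_
    deMorgan-∨ : ∀ x y → (‾ (x ∨ y)) ≈ ((‾ x) ∧ (‾ y))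
    deMorgan-∧ : ∀ x y → (‾ (x ∧ y)) ≈ ((‾ x) ∨ (‾ y))

  open IsDistributiveLattice isDistributiveLattice public

module FuzzyLogic {c ℓ p : Level} (K : DeMorganAlgebra c ℓ) (P : Set p) where
  open DeMorganAlgebra K

  Interaction : Set (c ⊔ ℓ ⊔ p)
  Interaction = Σ (P → Carrier) λ α → ∃ λ q → ¬ (α q ≈ 0#)

  -- fC(P,K): nonempty finite sets of interactions, represented by
  -- nonempty lists (the semantics below only depends on the underlying set)
  fC : Set (c ⊔ ℓ ⊔ p)
  fC = List⁺ Interaction

  data PIL : Set p where
    true : PIL
    port : P → PIL
    !_   : PIL → PIL
    _⊔ᴵ_ : PIL → PIL → PIL

  _⊓ᴵ_ : PIL → PIL → PIL
  φ₁ ⊓ᴵ φ₂ = ! ((! φ₁) ⊔ᴵ (! φ₂))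

  ⟦_⟧ᴵ : PIL → Interaction → Carrier
  ⟦ true ⟧ᴵ α = 1#
  ⟦ port q ⟧ᴵ (α , _) = α q
  ⟦ ! φ ⟧ᴵ α = ‾ (⟦ φ ⟧ᴵ α)
  ⟦ φ₁ ⊔ᴵ φ₂ ⟧ᴵ α = ⟦ φ₁ ⟧ᴵ α ∨ ⟦ φ₂ ⟧ᴵ α

  data PCL : Set p where
    pil  : PIL → PCL
    ¬ᶜ_  : PCL → PCL
    _⊕_  : PCL → PCL → PCL
    _⊎ᶜ_ : PCL → PCL → PCL

  _⊗_ : PCL → PCL → PCL
  ζ₁ ⊗ ζ₂ = ¬ᶜ ((¬ᶜ ζ₁) ⊕ (¬ᶜ ζ₂))

  -- all ways to distribute the elements of a list over two lists such that
  -- every element goes to the left, to the right, or to both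
  -- (i.e. all pairs (γ₁,γ₂) with γ₁ ∪ γ₂ = γ)
  splits : {A : Set (c ⊔ ℓ ⊔ p)} → List A → List (List A × List A)
  splits [] = ([] , []) ∷ []
  splits (x ∷ xs) = concatMap
    (λ { (l , r) → (x ∷ l , r) ∷ (l , x ∷ r) ∷ (x ∷ l , x ∷ r) ∷ [] })
    (splits xs)

  ⋀ : List Carrier → Carrier
  ⋀ = foldr _∧_ 1#

  ⋁ : List Carrier → Carrier
  ⋁ = foldr _∨_ 0#

  -- value of a decomposition; only decompositions into two nonempty sets count
  splitValue : (fC → Carrier) → (fC → Carrier) →
               List Interaction × List Interaction → Carrier
  splitValue f g (l , r) with fromList l | fromList r
  ... | just γ₁ | just γ₂ = f γ₁ ∧ g γ₂
  ... | _       | _       = 0#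

  ⟦_⟧ : PCL → fC → Carrier
  ⟦ pil φ ⟧ γ = ⋀ (map ⟦ φ ⟧ᴵ (toList γ))
  ⟦ ¬ᶜ ζ ⟧ γ = ‾ (⟦ ζ ⟧ γ)
  ⟦ ζ₁ ⊕ ζ₂ ⟧ γ = ⟦ ζ₁ ⟧ γ ∨ ⟦ ζ₂ ⟧ γ
  ⟦ ζ₁ ⊎ᶜ ζ₂ ⟧ γ = ⋁ (map (splitValue ⟦ ζ₁ ⟧ ⟦ ζ₂ ⟧) (splits (toList γ)))

  _≡ᶜ_ : PCL → PCL → Set (c ⊔ ℓ ⊔ p)
  ζ₁ ≡ᶜ ζ₂ = ∀ γ → ⟦ ζ₁ ⟧ γ ≈ ⟦ ζ₂ ⟧ γ

-- Both sides evaluate to a meet: a fuzzy interaction satisfies φ₁ ⊓ φ₂ to degree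
-- ⟦φ₁⟧ ∧ ⟦φ₂⟧ by De Morgan and involutivity, and the meet over the interactions of
-- a set of pointwise meets splits into the meet of the two meets.
module Submission where

open import Defs
open import Level using (Level)
open import Data.List using ([]; _∷_; map; foldr)
open import Data.List.NonEmpty using (toList)
open import Data.Product using (proj₁)
open import Algebra.Bundles using (CommutativeSemigroup)
import Algebra.Properties.CommutativeSemigroup as CommutativeSemigroupProperties
import Relation.Binary.Reasoning.Setoid as SetoidReasoning
open import Relation.Binary.Bundles using (Setoid)

module DeMorganAlgebraProperties {c ℓ : Level} (K : DeMorganAlgebra c ℓ) where
  open DeMorganAlgebra K

  setoid : Setoid c ℓ
  setoid = record { isEquivalence = isEquivalence }

  ∧-commutativeSemigroup : CommutativeSemigroup c ℓ
  ∧-commutativeSemigroup = record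
    { isCommutativeSemigroup = record
      { isSemigroup = record
        { isMagma = record { isEquivalence = isEquivalence ; ∙-cong = ∧-cong }
        ; assoc = ∧-assoc
        }
      ; comm = ∧-comm
      }
    }

  open CommutativeSemigroupProperties ∧-commutativeSemigroup
    renaming (interchange to ∧-interchange)
  open SetoidReasoning setoid

  ‾[‾∨‾]≈∧ : ∀ x y → ‾ ((‾ x) ∨ (‾ y)) ≈ x ∧ y
  ‾[‾∨‾]≈∧ x y = begin
    ‾ ((‾ x) ∨ (‾ y))     ≈⟨ deMorgan-∨ (‾ x) (‾ y) ⟩
    (‾ (‾ x)) ∧ (‾ (‾ y)) ≈⟨ ∧-cong (‾-involutive x) (‾-involutive y) ⟩
    x ∧ y                 ∎

  module _ {a : Level} {A : Set a} where

    ⋀-map-cong : {f g : A → Carrier} → (∀ x → f x ≈ g x) →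
                 ∀ xs → foldr _∧_ 1# (map f xs) ≈ foldr _∧_ 1# (map g xs)
    ⋀-map-cong f≈g []       = refl
    ⋀-map-cong f≈g (x ∷ xs) = ∧-cong (f≈g x) (⋀-map-cong f≈g xs)

    ⋀-map-∧ : (f g : A → Carrier) → ∀ xs →
              foldr _∧_ 1# (map (λ x → f x ∧ g x) xs)
                ≈ foldr _∧_ 1# (map f xs) ∧ foldr _∧_ 1# (map g xs)
    ⋀-map-∧ f g []       = sym (proj₁ ∧-identity 1#)
    ⋀-map-∧ f g (x ∷ xs) = begin
      (f x ∧ g x) ∧ foldr _∧_ 1# (map (λ x → f x ∧ g x) xs)
        ≈⟨ ∧-cong refl (⋀-map-∧ f g xs) ⟩
      (f x ∧ g x) ∧ (foldr _∧_ 1# (map f xs) ∧ foldr _∧_ 1# (map g xs))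
        ≈⟨ ∧-interchange (f x) (g x) _ _ ⟩
      (f x ∧ foldr _∧_ 1# (map f xs)) ∧ (g x ∧ foldr _∧_ 1# (map g xs))
        ∎

module _ {c ℓ p : Level} (K : DeMorganAlgebra c ℓ) (P : Set p) where
  open DeMorganAlgebra K
  open DeMorganAlgebraProperties K
  open FuzzyLogic K P

  ⟦⊓ᴵ⟧ᴵ : ∀ φ₁ φ₂ α → ⟦ φ₁ ⊓ᴵ φ₂ ⟧ᴵ α ≈ ⟦ φ₁ ⟧ᴵ α ∧ ⟦ φ₂ ⟧ᴵ α
  ⟦⊓ᴵ⟧ᴵ φ₁ φ₂ α = ‾[‾∨‾]≈∧ (⟦ φ₁ ⟧ᴵ α) (⟦ φ₂ ⟧ᴵ α)

  ⟦pil⊓ᴵ⟧ : ∀ φ₁ φ₂ γ → ⟦ pil (φ₁ ⊓ᴵ φ₂) ⟧ γ ≈ ⟦ pil φ₁ ⟧ γ ∧ ⟦ pil φ₂ ⟧ γ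
  ⟦pil⊓ᴵ⟧ φ₁ φ₂ γ =
    trans (⋀-map-cong (⟦⊓ᴵ⟧ᴵ φ₁ φ₂) (toList γ)) (⋀-map-∧ ⟦ φ₁ ⟧ᴵ ⟦ φ₂ ⟧ᴵ (toList γ))

  ⟦⊗⟧ : ∀ ζ₁ ζ₂ γ → ⟦ ζ₁ ⊗ ζ₂ ⟧ γ ≈ ⟦ ζ₁ ⟧ γ ∧ ⟦ ζ₂ ⟧ γ
  ⟦⊗⟧ ζ₁ ζ₂ γ = ‾[‾∨‾]≈∧ (⟦ ζ₁ ⟧ γ) (⟦ ζ₂ ⟧ γ)

mainTheorem4 : {c ℓ p : Level} (K : DeMorganAlgebra c ℓ) (P : Set p)
    → let open FuzzyLogic K P in
      (φ₁ φ₂ : PIL) → pil (φ₁ ⊓ᴵ φ₂) ≡ᶜ (pil φ₁ ⊗ pil φ₂)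
mainTheorem4 K P φ₁ φ₂ γ =
  trans (⟦pil⊓ᴵ⟧ K P φ₁ φ₂ γ) (sym (⟦⊗⟧ K P (pil φ₁) (pil φ₂) γ))
  where open DeMorganAlgebra K
        open FuzzyLogic K P
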